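{- For every integer $k\geq 1$, every graph of minimum degree at least $2k+1$ contains $k$ cycles of even length whose lengths are pairwise different.
   Context: All graphs are finite and simple. The cycles are not required to be vertex-disjoint. The length of a cycle is its number of vertices. -}

module Defs where

open import Data.Nat using (ℕ; suc; _≤_; _+_; _*_)
open import Data.Fin using (Fin)
open import Data.List using (List; []; _∷_; length; filter; allFin)
open import Data.List.Relation.Unary.Unique.Propositional using (Unique)
open import Data.Product using (_×_; Σ)
open import Relation.Nullary using (¬_; Dec)
open import Relation.Unary using (Decidable)
open import Relation.Binary.PropositionalEquality using (_≡_)

record Graph (n : ℕ) : Set₁ where
  field
    Adj     : Fin n → Fin n → Set
    adj?    : (u v : Fin n) → Dec (Adj u v)
    sym     : ∀ {u v} → Adj u v → Adj v u
    irrefl  : ∀ {u} → ¬ Adj u u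

module _ {n : ℕ} (G : Graph n) where
  open Graph G

  degree : Fin n → ℕ
  degree v = length (filter (adj? v) (allFin n))

  MinDegree≥ : ℕ → Set
  MinDegree≥ d = ∀ v → d ≤ degree v

  data Path : List (Fin n) → Set where
    []  : Path []
    [_] : ∀ v → Path (v ∷ [])
    _∷_ : ∀ {u v vs} → Adj u v → Path (v ∷ vs) → Path (u ∷ v ∷ vs)

  -- A cycle v₀ v₁ … v_{ℓ-1}: ℓ ≥ 3 pairwise distinct vertices, consecutive
  -- ones adjacent and v_{ℓ-1} adjacent to v₀.  Its length is ℓ.
  record Cycle : Set where
    constructor cycle
    field
      first    : Fin n
      rest     : List (Fin n)
      last     : Fin n
      distinct : Unique (first ∷ rest Data.List.++ (last ∷ []))
      path     : Path (first ∷ rest Data.List.++ (last ∷ []))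
      closing  : Adj last first
      long     : 1 ≤ length rest

  cycleLength : Cycle → ℕ
  cycleLength C = 2 + length (Cycle.rest C)

-- Take a maximal path v₀ v₁ … v_m.  By maximality all of the at least 2k+1
-- neighbours of v₀ lie on it, so k+1 of them have indices of the same parity.
-- If v_i is the first of these, each later one v_j closes the cycle
-- v₀ v_i v_{i+1} … v_j, of even length j − i + 2, and these k lengths differ.

module Submission where

open import Defs
open import Data.Nat using (ℕ; zero; suc; pred; _≤_; _<_; _+_; _*_; z≤n; s≤s)
open import Data.Nat.Properties
  using (+-comm; +-identityʳ; +-suc; +-cancelˡ-≤; +-monoˡ-≤; ≤-refl; ≤-reflexive; ≤-trans;
         n≤1+n; m≤n+m; +-monoʳ-≤; <⇒≢; <⇒≱; ≮⇒≥; <⇒≤pred; _<?_; module ≤-Reasoning)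
open import Data.Nat.Divisibility using (_∣_; divides; ∣m∣n⇒∣m+n)
open import Data.Nat.Tactic.RingSolver using (solve-∀)
open import Data.Fin using (Fin; inject≤; _≟_) renaming (zero to fzero; suc to fsuc)
open import Data.Fin.Properties using (inject≤-injective)
open import Data.List using (List; []; _∷_; _++_; _∷ʳ_; length; filter; allFin; lookup)
open import Data.List.Properties using (length-++; length-removeAt′; length-tabulate; ∷ʳ-++)
open import Data.List.Relation.Unary.All as All using (All; []; _∷_)
open import Data.List.Relation.Unary.All.Properties using (++⁻ˡ; ¬Any⇒All¬)
open import Data.List.Relation.Unary.AllPairs using (AllPairs; []; _∷_)
open import Data.List.Relation.Unary.Any using (here; there; any?; satisfied; index; _─_)
open import Data.List.Relation.Unary.Unique.Propositional using (Unique)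
open import Data.List.Relation.Unary.Unique.Propositional.Properties using (filter⁺; allFin⁺)
open import Data.List.Relation.Binary.Subset.Propositional using (_⊆_)
open import Data.List.Membership.Propositional using (_∈_; lose)
open import Data.List.Membership.Propositional.Properties using (∈-filter⁺; ∈-filter⁻; ∈-allFin; ∈-lookup)
open import Data.Product using (Σ; _×_; _,_)
open import Data.Sum using (_⊎_; inj₁; inj₂; [_,_]′)
open import Relation.Nullary using (yes; no; ¬?; _×-dec_; contradiction)
open import Relation.Unary using (Pred; Decidable)
open import Relation.Binary.PropositionalEquality using (_≡_; _≢_; refl; sym; trans; cong; subst)
open ≤-Reasoning

module _ {A : Set} where

  ∈-─⁺ : ∀ {x z : A} {ys} (x∈ys : x ∈ ys) → z ∈ ys → z ≢ x → z ∈ (ys ─ x∈ys)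
  ∈-─⁺ (here refl) (here refl) z≢x = contradiction refl z≢x
  ∈-─⁺ (here refl) (there z∈ys) _  = z∈ys
  ∈-─⁺ (there _)   (here refl) _   = here refl
  ∈-─⁺ (there x∈ys) (there z∈ys) z≢x = there (∈-─⁺ x∈ys z∈ys z≢x)

  Unique-⊆⇒length≤ : ∀ {xs ys : List A} → Unique xs → xs ⊆ ys → length xs ≤ length ys
  Unique-⊆⇒length≤ {[]} _ _ = z≤n
  Unique-⊆⇒length≤ {x ∷ xs} {ys} (x∉xs ∷ xs!) xs⊆ys = begin
    suc (length xs)          ≤⟨ s≤s (Unique-⊆⇒length≤ xs! xs⊆ys─x) ⟩
    suc (length (ys ─ x∈ys)) ≡⟨ length-removeAt′ ys (index x∈ys) ⟨
    length ys                ∎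
    where
    x∈ys = xs⊆ys (here refl)
    xs⊆ys─x : xs ⊆ (ys ─ x∈ys)
    xs⊆ys─x z∈xs = ∈-─⁺ x∈ys (xs⊆ys (there z∈xs)) λ { refl → All.lookup x∉xs z∈xs refl }

  Unique-++⁻ˡ : ∀ xs {ys : List A} → Unique (xs ++ ys) → Unique xs
  Unique-++⁻ˡ []       _          = []
  Unique-++⁻ˡ (x ∷ xs) (x∉ ∷ xs!) = ++⁻ˡ xs x∉ ∷ Unique-++⁻ˡ xs xs!

  length-∷ʳ : ∀ (xs : List A) x → length (xs ∷ʳ x) ≡ suc (length xs)
  length-∷ʳ xs x = trans (length-++ xs) (+-comm (length xs) 1)

  evens odds : List A → List A
  evens []       = []
  evens (x ∷ xs) = x ∷ odds xs
  odds []       = []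
  odds (x ∷ xs) = evens xs

module _ {A : Set} {p} {P : Pred A p} (P? : Decidable P) where

  length-filter-evens+odds : ∀ xs →
    length (filter P? (evens xs)) + length (filter P? (odds xs)) ≡ length (filter P? xs)
  length-filter-evens+odds []       = refl
  length-filter-evens+odds (x ∷ xs) with P? x
  ... | yes _ =
    cong suc (trans (+-comm (length (filter P? (odds xs))) _) (length-filter-evens+odds xs))
  ... | no  _ = trans (+-comm (length (filter P? (odds xs))) _) (length-filter-evens+odds xs)

module _ {A : Set} (f : A → ℕ) where

  AllPairs-<-lookup-injective : ∀ {xs} → AllPairs (λ a b → f a < f b) xs →
    ∀ i j → f (lookup xs i) ≡ f (lookup xs j) → i ≡ j
  AllPairs-<-lookup-injective (_ ∷ _) fzero fzero _ = refl
  AllPairs-<-lookup-injective (x< ∷ _) fzero (fsuc j) eq =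
    contradiction eq (<⇒≢ (All.lookup x< (∈-lookup j)))
  AllPairs-<-lookup-injective (x< ∷ _) (fsuc i) fzero eq =
    contradiction (sym eq) (<⇒≢ (All.lookup x< (∈-lookup i)))
  AllPairs-<-lookup-injective (_ ∷ xs<) (fsuc i) (fsuc j) eq =
    cong fsuc (AllPairs-<-lookup-injective xs< i j eq)

2*k+1≡k+[1+k] : ∀ k → 2 * k + 1 ≡ k + suc k
2*k+1≡k+[1+k] = solve-∀

pigeonhole-+ : ∀ k a b → 2 * k + 1 ≤ a + b → k < a ⊎ k < b
pigeonhole-+ k a b 2k+1≤a+b with k <? a
... | yes k<a = inj₁ k<a
... | no  k≮a = inj₂ (+-cancelˡ-≤ k (suc k) b (begin
  k + suc k ≡⟨ 2*k+1≡k+[1+k] k ⟨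
  2 * k + 1 ≤⟨ 2k+1≤a+b ⟩
  a + b     ≤⟨ +-monoˡ-≤ b (≮⇒≥ k≮a) ⟩
  k + b     ∎))

module _ {n : ℕ} (G : Graph n) where
  open Graph G renaming (sym to Adj-sym)
  open import Data.List.Membership.DecPropositional (_≟_ {n}) using (_∈?_)

  private
    V = Fin n

  neighboursIn : V → List V → ℕ
  neighboursIn v xs = length (filter (adj? v) xs)

  Path-tail : ∀ {x xs} → Path G (x ∷ xs) → Path G xs
  Path-tail [ _ ]     = []
  Path-tail (_ ∷ xs~) = xs~

  Path-++⁻ˡ : ∀ xs {ys} → Path G (xs ++ ys) → Path G xs
  Path-++⁻ˡ []           _          = []
  Path-++⁻ˡ (x ∷ [])     _          = [ x ]
  Path-++⁻ˡ (x ∷ y ∷ xs) (x~y ∷ p) = x~y ∷ Path-++⁻ˡ (y ∷ xs) p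

  Unique⇒length≤ : ∀ {xs : List V} → Unique xs → length xs ≤ n
  Unique⇒length≤ {xs} xs! = begin
    length xs         ≤⟨ Unique-⊆⇒length≤ xs! (λ {z} _ → ∈-allFin z) ⟩
    length (allFin n) ≡⟨ length-tabulate (λ i → i) ⟩
    n                 ∎

  record MaximalPath : Set where
    field
      end    : V
      rest   : List V
      unique : Unique (end ∷ rest)
      path   : Path G (end ∷ rest)
      closed : ∀ {u} → Adj end u → u ∈ rest

  extendToMaximal : ∀ fuel h w → n < length (h ∷ w) + fuel →
    Unique (h ∷ w) → Path G (h ∷ w) → MaximalPath
  extendToMaximal zero h w n<len hw! _ =
    contradiction (Unique⇒length≤ hw!) (<⇒≱ (subst (n <_) (+-identityʳ _) n<len))
  extendToMaximal (suc fuel) h w n<len hw! hw~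
    with any? (λ v → adj? h v ×-dec ¬? (v ∈? w)) (allFin n)
  ... | yes fresh with (v , h~v , v∉w) ← satisfied fresh =
    extendToMaximal fuel v (h ∷ w) (subst (n <_) (+-suc _ fuel) n<len)
      (((λ { refl → irrefl h~v }) ∷ ¬Any⇒All¬ w v∉w) ∷ hw!) (Adj-sym h~v ∷ hw~)
  ... | no  none = record { end = h ; rest = w ; unique = hw! ; path = hw~ ; closed = closed }
    where
    closed : ∀ {u} → Adj h u → u ∈ w
    closed {u} h~u with u ∈? w
    ... | yes u∈w = u∈w
    ... | no  u∉w = contradiction (lose (∈-allFin u) (h~u , u∉w)) none

  maximalPath : V → MaximalPath
  maximalPath v = extendToMaximal n v [] ≤-refl ([] ∷ []) [ v ]

  degree≤neighboursOnPath : (P : MaximalPath) →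
    let open MaximalPath P in degree G end ≤ neighboursIn end rest
  degree≤neighboursOnPath P = Unique-⊆⇒length≤ (filter⁺ (adj? end) (allFin⁺ n)) neighbours⊆
    where
    open MaximalPath P
    neighbours⊆ : filter (adj? end) (allFin n) ⊆ filter (adj? end) rest
    neighbours⊆ u∈ with (_ , end~u) ← ∈-filter⁻ (adj? end) {xs = allFin n} u∈ =
      ∈-filter⁺ (adj? end) (closed end~u) end~u

  -- The bound lo is what allows a shorter cycle to be put in front.
  record IncreasingEvenCycles (lo c : ℕ) : Set where
    field
      cycles     : List (Cycle G)
      even       : All (λ C → 2 ∣ cycleLength G C) cycles
      bounded    : All (λ C → lo ≤ cycleLength G C) cycles
      increasing : AllPairs (λ C D → cycleLength G C < cycleLength G D) cycles
      many       : c ≤ length cycles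

  noCycles : ∀ {lo} → IncreasingEvenCycles lo 0
  noCycles = record { cycles = [] ; even = [] ; bounded = [] ; increasing = [] ; many = z≤n }

  lowerBound : ∀ {lo lo′ c} → lo′ ≤ lo → IncreasingEvenCycles lo c → IncreasingEvenCycles lo′ c
  lowerBound lo′≤lo E = record
    { cycles = cycles ; even = even ; bounded = All.map (≤-trans lo′≤lo) bounded
    ; increasing = increasing ; many = many }
    where open IncreasingEvenCycles E

  consCycle : ∀ {lo c} (C : Cycle G) → 2 ∣ cycleLength G C → lo ≤ cycleLength G C →
    IncreasingEvenCycles (suc (cycleLength G C)) c → IncreasingEvenCycles lo (suc c)
  consCycle C even-C lo≤C E = record
    { cycles     = C ∷ cycles
    ; even       = even-C ∷ even
    ; bounded    = lo≤C ∷ All.map (≤-trans (≤-trans lo≤C (n≤1+n _))) bounded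
    ; increasing = bounded ∷ increasing
    ; many       = s≤s many
    }
    where open IncreasingEvenCycles E

  PathAvoiding : V → List V → Set
  PathAvoiding v xs = Unique (v ∷ xs) × Path G xs

  PathAvoiding-tail : ∀ {v x xs} → PathAvoiding v (x ∷ xs) → PathAvoiding v xs
  PathAvoiding-tail ((_ ∷ v∉xs) ∷ (_ ∷ xs!) , x∷xs~) = v∉xs ∷ xs! , Path-tail x∷xs~

  PathAvoiding-++⁻ˡ : ∀ {v} xs {ys} → PathAvoiding v (xs ++ ys) → PathAvoiding v xs
  PathAvoiding-++⁻ˡ {v} xs (vxsys! , xsys~) = Unique-++⁻ˡ (v ∷ xs) vxsys! , Path-++⁻ˡ xs xsys~

  closeCycle : ∀ {v x y} q → Adj v x → Adj y v → PathAvoiding v (x ∷ q ∷ʳ y) → Cycle G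
  closeCycle q v~x y~v (vxqy! , xqy~) = cycle _ (_ ∷ q) _ vxqy! (v~x ∷ xqy~) y~v (s≤s z≤n)

  module _ (v : V) where

    -- Since q has even length, the vertices in odds S lie at even distance ≥ 2
    -- from x along the path, so each neighbour z of v among them closes the
    -- even cycle v x q … z.
    fanFrom : ∀ x q S → Adj v x → 2 ∣ length q → PathAvoiding v (x ∷ q ++ S) →
      IncreasingEvenCycles (4 + length q) (neighboursIn v (odds S))
    fanFrom x q []           _   _    _    = noCycles
    fanFrom x q (_ ∷ [])     _   _    _    = noCycles
    fanFrom x q (y ∷ z ∷ S) v~x 2∣q xqS⊥v = step
      where
      length-qyz : length (q ∷ʳ y ∷ʳ z) ≡ 2 + length q
      length-qyz = trans (length-∷ʳ (q ∷ʳ y) z) (cong suc (length-∷ʳ q y))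
      xqyzS⊥v : PathAvoiding v (x ∷ (q ∷ʳ y ∷ʳ z) ++ S)
      xqyzS⊥v = subst (λ xs → PathAvoiding v (x ∷ xs))
        (sym (trans (∷ʳ-++ (q ∷ʳ y) z S) (∷ʳ-++ q y (z ∷ S)))) xqS⊥v
      later : IncreasingEvenCycles (4 + length (q ∷ʳ y ∷ʳ z)) (neighboursIn v (odds S))
      later = fanFrom x (q ∷ʳ y ∷ʳ z) S v~x
        (subst (2 ∣_) (sym length-qyz) (∣m∣n⇒∣m+n (divides 1 refl) 2∣q)) xqyzS⊥v
      step : IncreasingEvenCycles (4 + length q) (neighboursIn v (z ∷ odds S))
      step with adj? v z
      ... | yes v~z = consCycle C even-C (≤-reflexive (sym lengthC)) (lowerBound C<later later)
          where
          C = closeCycle (q ∷ʳ y) v~x (Adj-sym v~z) (PathAvoiding-++⁻ˡ (x ∷ q ∷ʳ y ∷ʳ z) xqyzS⊥v)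
          lengthC : cycleLength G C ≡ 4 + length q
          lengthC = cong (3 +_) (length-∷ʳ q y)
          even-C : 2 ∣ cycleLength G C
          even-C = subst (2 ∣_) (sym lengthC) (∣m∣n⇒∣m+n (divides 2 refl) 2∣q)
          C<later : cycleLength G C < 4 + length (q ∷ʳ y ∷ʳ z)
          C<later = ≤-trans (n≤1+n _) (≤-reflexive (cong (4 +_) (sym (length-∷ʳ (q ∷ʳ y) z))))
      ... | no  _   =
        lowerBound (+-monoʳ-≤ 4 (≤-trans (m≤n+m _ 2) (≤-reflexive (sym length-qyz)))) later

    fanEvens : ∀ S → PathAvoiding v S → IncreasingEvenCycles 0 (pred (neighboursIn v (evens S)))
    fanOdds  : ∀ S → PathAvoiding v S → IncreasingEvenCycles 0 (pred (neighboursIn v (odds S)))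

    fanEvens []      _    = noCycles
    fanEvens (x ∷ S) xS⊥v with adj? v x
    ... | yes v~x = lowerBound z≤n (fanFrom x [] S v~x (divides 0 refl) xS⊥v)
    ... | no  _   = fanOdds S (PathAvoiding-tail xS⊥v)

    fanOdds []      _    = noCycles
    fanOdds (_ ∷ S) xS⊥v = fanEvens S (PathAvoiding-tail xS⊥v)

  distinctEvenCycles : ∀ {k lo c} → k ≤ c → IncreasingEvenCycles lo c →
    Σ (Fin k → Cycle G) λ C →
      (∀ i → 2 ∣ cycleLength G (C i)) ×
      (∀ i j → cycleLength G (C i) ≡ cycleLength G (C j) → i ≡ j)
  distinctEvenCycles k≤c E =
    (λ i → lookup cycles (inject≤ i k≤len)) ,
    (λ i → All.lookup even (∈-lookup (inject≤ i k≤len))) ,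
    (λ i j eq → inject≤-injective k≤len k≤len i j
      (AllPairs-<-lookup-injective (cycleLength G) increasing _ _ eq))
    where
    open IncreasingEvenCycles E
    k≤len = ≤-trans k≤c many

theorem2p3 : (k : ℕ) → 1 ≤ k → (n : ℕ) → 1 ≤ n → (G : Graph n) →
    MinDegree≥ G (2 * k + 1) →
    Σ (Fin k → Cycle G) λ C →
      (∀ i → 2 ∣ cycleLength G (C i)) ×
      (∀ i j → cycleLength G (C i) ≡ cycleLength G (C j) → i ≡ j)
theorem2p3 k _ (suc m) _ G δ≥2k+1 =
  [ (λ k<evens → distinctEvenCycles G (<⇒≤pred k<evens) (fanEvens G end rest rest⊥end))
  , (λ k<odds  → distinctEvenCycles G (<⇒≤pred k<odds)  (fanOdds  G end rest rest⊥end))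
  ]′ (pigeonhole-+ k (neighboursIn G end (evens rest)) (neighboursIn G end (odds rest))
        2k+1≤neighbours)
  where
  P = maximalPath G fzero
  open MaximalPath P
  rest⊥end : PathAvoiding G end rest
  rest⊥end = unique , Path-tail G path
  2k+1≤neighbours : 2 * k + 1 ≤ neighboursIn G end (evens rest) + neighboursIn G end (odds rest)
  2k+1≤neighbours = begin
    2 * k + 1               ≤⟨ δ≥2k+1 end ⟩
    degree G end            ≤⟨ degree≤neighboursOnPath G P ⟩
    neighboursIn G end rest ≡⟨ length-filter-evens+odds (Graph.adj? G end) rest ⟨
    _                       ∎
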